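{- Let $G$ be the Heawood graph. Then $M(G)=Z(G)=6$.
   Context: The Heawood graph is the point–line incidence graph of the Fano plane (projective plane of order $2$): a $3$-regular bipartite graph on $14$ vertices (the $7$ points and $7$ lines), a point adjacent to a line iff it lies on it. For a graph $G$ on vertices $v_1,\dots,v_n$, $S(G)$ is the set of real symmetric $n\times n$ matrices $A$ with $a_{ij}\neq0$ iff $v_iv_j\in E(G)$ for $i\neq j$ (diagonal arbitrary); $M(G)$ is the maximum nullity over $S(G)$. Zero forcing: if a black vertex has exactly one white neighbour, that neighbour becomes black; $Z(G)$ is the minimum size of an initial black set from which repeated application of this rule makes all vertices black. -}

module Defs where

open import Level using (0ℓ)
open import Algebra.Bundles using (CommutativeRing)
open import Data.Nat using (ℕ; zero; suc; _≤_)
open import Data.Fin using (Fin; zero; suc; toℕ)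
open import Data.Fin.Subset using (Subset; _∈_; ∣_∣)
open import Data.Bool using (Bool; true; false; T)
open import Data.Product using (Σ; ∃; _×_; _,_)
open import Data.Sum using (_⊎_)
open import Relation.Nullary using (¬_)
open import Relation.Binary.PropositionalEquality using (_≡_)
open import Data.Nat.DivMod using (_%_)
import Data.Nat as N

record Graph (n : ℕ) : Set₁ where
  field
    Adj     : Fin n → Fin n → Set
    symAdj  : ∀ {u v} → Adj u v → Adj v u
    irrefl  : ∀ {u} → ¬ Adj u u

-- The Heawood graph: vertices 0..6 are the points of the Fano plane
-- (elements of ℤ/7), vertices 7..13 are its lines: line j (vertex 7+j)
-- is {j, j+1, j+3} mod 7 (the standard difference-set model of PG(2,2)).

onLine : ℕ → ℕ → Bool
onLine p j with (p N.+ 7 N.∸ j) % 7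
... | 0 = true
... | 1 = true
... | 3 = true
... | _ = false

heawoodAdjB : ℕ → ℕ → Bool
heawoodAdjB u v with u N.<ᵇ 7 | v N.<ᵇ 7
... | true  | false = onLine u (v N.∸ 7)
... | false | true  = onLine v (u N.∸ 7)
... | _     | _     = false

heawoodAdjB-sym : ∀ u v → heawoodAdjB u v ≡ heawoodAdjB v u
heawoodAdjB-sym u v with u N.<ᵇ 7 | v N.<ᵇ 7
... | true  | true  = Relation.Binary.PropositionalEquality.refl
... | true  | false = Relation.Binary.PropositionalEquality.refl
... | false | true  = Relation.Binary.PropositionalEquality.refl
... | false | false = Relation.Binary.PropositionalEquality.refl

heawoodAdjB-irr : ∀ u → heawoodAdjB u u ≡ false
heawoodAdjB-irr u with u N.<ᵇ 7
... | true  = Relation.Binary.PropositionalEquality.refl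
... | false = Relation.Binary.PropositionalEquality.refl

Heawood : Graph 14
Heawood = record
  { Adj    = λ u v → T (heawoodAdjB (toℕ u) (toℕ v))
  ; symAdj = λ {u} {v} a → Relation.Binary.PropositionalEquality.subst T (heawoodAdjB-sym (toℕ u) (toℕ v)) a
  ; irrefl = λ {u} a → Relation.Binary.PropositionalEquality.subst T (heawoodAdjB-irr (toℕ u)) a
  }

data Black {n} (G : Graph n) (S : Subset n) : Fin n → Set where
  init  : ∀ {v} → v ∈ S → Black G S v
  force : ∀ {u v} → Black G S u → Graph.Adj G u v →
          (∀ w → Graph.Adj G u w → ¬ (w ≡ v) → Black G S w) →
          Black G S v

IsZeroForcingSet : ∀ {n} → Graph n → Subset n → Set
IsZeroForcingSet G S = ∀ v → Black G S v

ZeroForcingNumber : ∀ {n} → Graph n → ℕ → Set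
ZeroForcingNumber {n} G k =
  (Σ (Subset n) λ S → IsZeroForcingSet G S × ∣ S ∣ ≡ k) ×
  (∀ S → IsZeroForcingSet G S → k ≤ ∣ S ∣)

-- The real numbers, axiomatised as a Dedekind-complete ordered field
-- (this determines ℝ up to isomorphism).  agda-stdlib has no reals.

record RealField : Set₁ where
  field
    commRing : CommutativeRing 0ℓ 0ℓ
  open CommutativeRing commRing public
  field
    1≉0      : ¬ (1# ≈ 0#)
    inverse  : ∀ x → ¬ (x ≈ 0#) → Σ Carrier λ y → (x * y) ≈ 1#
    _<_      : Carrier → Carrier → Set
    <-resp   : ∀ {x x′ y y′} → x ≈ x′ → y ≈ y′ → x < y → x′ < y′
    <-irrefl : ∀ {x} → ¬ (x < x)
    <-trans  : ∀ {x y z} → x < y → y < z → x < z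
    <-tri    : ∀ x y → (x < y) ⊎ ((x ≈ y) ⊎ (y < x))
    <-+      : ∀ {x y} z → x < y → (x + z) < (y + z)
    <-*      : ∀ {x y} → 0# < x → 0# < y → 0# < (x * y)
  _≤ᵣ_ : Carrier → Carrier → Set
  x ≤ᵣ y = (x < y) ⊎ (x ≈ y)
  IsUpperBound : (Carrier → Set) → Carrier → Set
  IsUpperBound P b = ∀ x → P x → x ≤ᵣ b
  field
    complete : (P : Carrier → Set) → (Σ Carrier P) →
               (Σ Carrier (IsUpperBound P)) →
               Σ Carrier λ s → IsUpperBound P s ×
                               (∀ b → IsUpperBound P b → s ≤ᵣ b)

module _ (ℝ : RealField) where
  open RealField ℝ using (Carrier; _≈_; _+_; _*_; 0#)

  Σᶠ : ∀ {n} → (Fin n → Carrier) → Carrier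
  Σᶠ {zero}  f = 0#
  Σᶠ {suc n} f = f zero + Σᶠ (λ i → f (suc i))

  Matrix : ℕ → Set
  Matrix n = Fin n → Fin n → Carrier

  InS : ∀ {n} → Graph n → Matrix n → Set
  InS G A = (∀ i j → A i j ≈ A j i) ×
            (∀ i j → ¬ (i ≡ j) →
               (Graph.Adj G i j → ¬ (A i j ≈ 0#)) ×
               (¬ (A i j ≈ 0#) → Graph.Adj G i j))

  InKernel : ∀ {n} → Matrix n → (Fin n → Carrier) → Set
  InKernel A x = ∀ i → Σᶠ (λ j → A i j * x j) ≈ 0#

  LinIndep : ∀ {n k} → (Fin k → Fin n → Carrier) → Set
  LinIndep {n} {k} vs = ∀ (c : Fin k → Carrier) →
    (∀ j → Σᶠ (λ i → c i * vs i j) ≈ 0#) → ∀ i → c i ≈ 0#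

  NullityAtLeast : ∀ {n} → Matrix n → ℕ → Set
  NullityAtLeast {n} A k =
    Σ (Fin k → Fin n → Carrier) λ vs → (∀ i → InKernel A (vs i)) × LinIndep vs

  MaxNullity : ∀ {n} → Graph n → ℕ → Set
  MaxNullity {n} G m =
    (Σ (Matrix n) λ A → InS G A × NullityAtLeast A m) ×
    (∀ A → InS G A → ¬ NullityAtLeast A (suc m))

module Submission where

-- M(G) ≤ Z(G) for every graph: if x is a kernel vector of A ∈ S(G) that vanishes on a zero
-- forcing set S, then each force u → v reads row u of A x = 0 as A u v * x v = 0, so x vanishes
-- everywhere; and more than ∣ S ∣ kernel vectors have a nontrivial combination vanishing on S.
-- For the Heawood graph the points 0, 1, 2 and lines 0, 1, 2 form a zero forcing set, while
-- [[I, N], [Nᵀ, 2I]] ∈ S(G) has nullity 6; hence 6 ≤ M(G) ≤ Z(G) ≤ 6.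

open import Defs
open import Data.Bool using (true; false; if_then_else_)
open import Data.Fin using (Fin; zero; suc; toℕ; punchIn; #_; _↑ʳ_; inject₁)
open import Data.Fin.Properties using (all?; any?; punchInᵢ≢i) renaming (_≟_ to _≟ᶠ_)
open import Data.Fin.Subset using (Subset; _∈_; ∣_∣; ⊤; ⁅_⁆; _∪_)
open import Data.Fin.Subset.Properties using (_∈?_; ∈⊤; x∈p∪q⁻; x∈⁅y⁆⇒x≡y)
open import Data.List using (List; []; _∷_)
open import Data.Nat as ℕ using (ℕ; zero; suc; _<_; _≤_; _≤?_; s≤s)
import Data.Nat.Properties as ℕₚ
open import Data.Product using (Σ; ∃; _×_; _,_; proj₁; proj₂)
open import Data.Sum using (_⊎_; inj₁; inj₂)
open import Data.Unit using (tt)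
open import Data.Vec using (_∷_; []; here; there)
open import Data.Vec.Functional using (insertAt)
open import Data.Vec.Functional.Properties using (insertAt-lookup; insertAt-punchIn)
open import Function using (_∘_)
open import Relation.Nullary using (¬_; Dec; yes; no; contradiction)
open import Relation.Nullary.Decidable using (_×-dec_; _→-dec_; ¬?; T?; from-yes; decidable-stable)
open import Relation.Binary.PropositionalEquality as ≡ using (_≡_; _≢_)
open import Algebra.Properties.Monoid.Sum ℕₚ.+-0-monoid using () renaming (sum to sumℕ)

module _ {n} (G : Graph n) (adj? : ∀ u v → Dec (Graph.Adj G u v)) where
  open Graph G

  CanForce : Subset n → Fin n → Fin n → Set
  CanForce B u v = u ∈ B × Adj u v × (∀ w → Adj u w → w ≢ v → w ∈ B)

  canForce? : ∀ B u v → Dec (CanForce B u v)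
  canForce? B u v =
    (u ∈? B) ×-dec adj? u v ×-dec all? (λ w → adj? u w →-dec ¬? (w ≟ᶠ v) →-dec w ∈? B)

  runForces : Subset n → List (Fin n × Fin n) → Subset n
  runForces B [] = B
  runForces B ((u , v) ∷ fs) with canForce? B u v
  ... | yes _ = runForces (B ∪ ⁅ v ⁆) fs
  ... | no  _ = runForces B fs

  runForces-black : ∀ {S} B fs → (∀ {v} → v ∈ B → Black G S v) →
                    ∀ {v} → v ∈ runForces B fs → Black G S v
  runForces-black B [] black = black
  runForces-black {S} B ((u , v) ∷ fs) black with canForce? B u v
  ... | no  _ = runForces-black B fs black
  ... | yes (u∈B , uv , others) = runForces-black (B ∪ ⁅ v ⁆) fs black′
    where
    black′ : ∀ {w} → w ∈ B ∪ ⁅ v ⁆ → Black G S w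
    black′ w∈ with x∈p∪q⁻ B ⁅ v ⁆ w∈
    ... | inj₁ w∈B = black w∈B
    ... | inj₂ w∈⁅v⁆ rewrite x∈⁅y⁆⇒x≡y v w∈⁅v⁆ =
      force (black u∈B) uv (λ w uw w≢v → black (others w uw w≢v))

  forcingChain⇒zeroForcing : ∀ S fs → runForces S fs ≡ ⊤ → IsZeroForcingSet G S
  forcingChain⇒zeroForcing S fs done v =
    runForces-black S fs init (≡.subst (v ∈_) (≡.sym done) ∈⊤)

module Nullity (ℝ : RealField) where
  open RealField ℝ hiding (zero; _<_)
  open import Algebra.Properties.Semiring.Sum semiring
  open import Algebra.Properties.Ring ring using (-‿distribˡ-*; -‿distribʳ-*; -1*x≈-x)
  open import Algebra.Properties.Semiring.Mult semiring
    using (×-homo-1; ×-homo-+; ×1-homo-*) renaming (_×_ to _×ᵣ_)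
  open import Algebra.Properties.CommutativeSemigroup *-commutativeSemigroup using (x∙yz≈y∙xz)
  open import Relation.Binary.Reasoning.Setoid setoid

  _≈0? : ∀ x → Dec (x ≈ 0#)
  x ≈0? with <-tri x 0#
  ... | inj₁ x<0        = no λ x≈0 → <-irrefl (<-resp x≈0 refl x<0)
  ... | inj₂ (inj₁ x≈0) = yes x≈0
  ... | inj₂ (inj₂ 0<x) = no λ x≈0 → <-irrefl (<-resp refl x≈0 0<x)

  findNonzero : ∀ {k} (f : Fin k → Carrier) → (∃ λ i → ¬ (f i ≈ 0#)) ⊎ (∀ i → f i ≈ 0#)
  findNonzero f with any? (λ i → ¬? (f i ≈0?))
  ... | yes found = inj₁ found
  ... | no  none  = inj₂ λ i → decidable-stable (f i ≈0?) (λ f≉0 → none (i , f≉0))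

  *-cancelˡ-≈0 : ∀ {a x} → ¬ (a ≈ 0#) → a * x ≈ 0# → x ≈ 0#
  *-cancelˡ-≈0 {a} {x} a≉0 ax≈0 with inverse a a≉0
  ... | a⁻¹ , aa⁻¹≈1 = begin
    x               ≈⟨ *-identityˡ x ⟨
    1# * x          ≈⟨ *-congʳ aa⁻¹≈1 ⟨
    (a * a⁻¹) * x   ≈⟨ *-congʳ (*-comm a a⁻¹) ⟩
    (a⁻¹ * a) * x   ≈⟨ *-assoc a⁻¹ a x ⟩
    a⁻¹ * (a * x)   ≈⟨ *-congˡ ax≈0 ⟩
    a⁻¹ * 0#        ≈⟨ zeroʳ a⁻¹ ⟩
    0#              ∎

  Σᶠ≡sum : ∀ {n} (f : Fin n → Carrier) → Σᶠ ℝ f ≡ sum f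
  Σᶠ≡sum {zero}  f = ≡.refl
  Σᶠ≡sum {suc n} f = ≡.cong (f zero +_) (Σᶠ≡sum (f ∘ suc))

  sum-zero : ∀ {n} {f : Fin n → Carrier} → (∀ i → f i ≈ 0#) → sum f ≈ 0#
  sum-zero {n} f≈0 = trans (sum-cong-≋ f≈0) (sum-replicate-zero n)

  sum-single : ∀ {n} {f : Fin n → Carrier} p → (∀ i → i ≢ p → f i ≈ 0#) → sum f ≈ f p
  sum-single {suc n} {f} p others = begin
    sum f                          ≈⟨ sum-remove {i = p} f ⟩
    f p + sum (f ∘ punchIn p)      ≈⟨ +-congˡ (sum-zero (λ i → others _ (punchInᵢ≢i p i))) ⟩
    f p + 0#                       ≈⟨ +-identityʳ (f p) ⟩
    f p                            ∎

  sum-neg : ∀ {n} (f : Fin n → Carrier) → sum (λ i → - f i) ≈ - sum f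
  sum-neg f = begin
    sum (λ i → - f i)       ≈⟨ sum-cong-≋ (λ i → -1*x≈-x (f i)) ⟨
    sum (λ i → - 1# * f i)  ≈⟨ *-distribˡ-sum (- 1#) f ⟨
    - 1# * sum f            ≈⟨ -1*x≈-x (sum f) ⟩
    - sum f                 ∎

  combination : ∀ {k n} → (Fin k → Fin n → Carrier) → (Fin k → Carrier) → Fin n → Carrier
  combination vs c j = sum (λ i → c i * vs i j)

  VanishingCombination : ∀ {k n} → Subset n → (Fin k → Fin n → Carrier) → Set
  VanishingCombination {k} S vs =
    Σ (Fin k → Carrier) λ c → (∃ λ i → ¬ (c i ≈ 0#)) × (∀ j → j ∈ S → combination vs c j ≈ 0#)

  combination-≈0 : ∀ {k n} (vs : Fin k → Fin n → Carrier) c {j} →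
                  (∀ i → vs i j ≈ 0#) → combination vs c j ≈ 0#
  combination-≈0 vs c column≈0 = sum-zero λ i → trans (*-congˡ (column≈0 i)) (zeroʳ (c i))

  tails : ∀ {k n} → (Fin k → Fin (suc n) → Carrier) → Fin k → Fin n → Carrier
  tails vs i j = vs i (suc j)

  private
    extendVanishing : ∀ {k n b} {S : Subset n} (vs : Fin k → Fin (suc n) → Carrier) c →
                      (b ≡ true → combination vs c zero ≈ 0#) →
                      (∀ j → j ∈ S → combination vs c (suc j) ≈ 0#) →
                      ∀ j → j ∈ (b ∷ S) → combination vs c j ≈ 0#
    extendVanishing vs c head≈0 tail≈0 zero    here      = head≈0 ≡.refl
    extendVanishing vs c head≈0 tail≈0 (suc j) (there m) = tail≈0 j m

  dropColumn : ∀ {k n b} {S : Subset n} (vs : Fin k → Fin (suc n) → Carrier) →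
               (b ≡ true → ∀ i → vs i zero ≈ 0#) →
               VanishingCombination S (tails vs) → VanishingCombination (b ∷ S) vs
  dropColumn vs column≈0 (c , nontrivial , vanishes) =
    c , nontrivial , extendVanishing vs c (λ b≡true → combination-≈0 vs c (column≈0 b≡true)) vanishes

  -- One step of Gaussian elimination: the pivot vector vs p clears the first column of the others.
  module Pivot {k n} (vs : Fin (suc k) → Fin (suc n) → Carrier) (p : Fin (suc k))
               (a⁻¹ : Carrier) (inv : vs p zero * a⁻¹ ≈ 1#) where

    scale : Fin k → Carrier
    scale i = - (vs (punchIn p i) zero * a⁻¹)

    cleared : Fin k → Fin (suc n) → Carrier
    cleared i j = vs (punchIn p i) j + scale i * vs p j

    cleared-first : ∀ i → cleared i zero ≈ 0#
    cleared-first i = begin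
      u + - (u * a⁻¹) * a    ≈⟨ +-congˡ (-‿distribˡ-* (u * a⁻¹) a) ⟨
      u + - ((u * a⁻¹) * a)  ≈⟨ +-congˡ (-‿cong (*-assoc u a⁻¹ a)) ⟩
      u + - (u * (a⁻¹ * a))  ≈⟨ +-congˡ (-‿cong (*-congˡ (trans (*-comm a⁻¹ a) inv))) ⟩
      u + - (u * 1#)         ≈⟨ +-congˡ (-‿cong (*-identityʳ u)) ⟩
      u + - u                ≈⟨ -‿inverseʳ u ⟩
      0#                     ∎
      where
      u = vs (punchIn p i) zero
      a = vs p zero

    lift : (Fin k → Carrier) → Fin (suc k) → Carrier
    lift d = insertAt d p (sum (λ i → d i * scale i))

    combination-lift : ∀ d j → combination vs (lift d) j ≈ combination cleared d j
    combination-lift d j = begin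
      sum (λ i → lift d i * vs i j)
        ≈⟨ sum-remove {i = p} (λ i → lift d i * vs i j) ⟩
      lift d p * vs p j + sum (λ i → lift d (punchIn p i) * vs (punchIn p i) j)
        ≈⟨ +-cong (*-congʳ (reflexive (insertAt-lookup d p X)))
                  (sum-cong-≋ (λ i → *-congʳ (reflexive (insertAt-punchIn d p X i)))) ⟩
      X * vs p j + D
        ≈⟨ +-comm (X * vs p j) D ⟩
      D + X * vs p j
        ≈⟨ +-congˡ (*-distribʳ-sum (vs p j) (λ i → d i * scale i)) ⟩
      D + sum (λ i → d i * scale i * vs p j)
        ≈⟨ ∑-distrib-+ (λ i → d i * vs (punchIn p i) j) (λ i → d i * scale i * vs p j) ⟨
      sum (λ i → d i * vs (punchIn p i) j + d i * scale i * vs p j)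
        ≈⟨ sum-cong-≋ (λ i → trans (+-congˡ (*-assoc (d i) (scale i) (vs p j)))
                                   (sym (distribˡ (d i) _ _))) ⟩
      sum (λ i → d i * cleared i j)
        ∎
      where
      X = sum (λ i → d i * scale i)
      D = sum (λ i → d i * vs (punchIn p i) j)

    liftVanishing : ∀ {b} {S : Subset n} →
                    VanishingCombination S (tails cleared) → VanishingCombination (b ∷ S) vs
    liftVanishing (d , (i , dᵢ≉0) , vanishes) =
      lift d , (punchIn p i , liftᵢ≉0) , extendVanishing vs (lift d) (λ _ → first≈0) tail≈0
      where
      liftᵢ≉0 : ¬ (lift d (punchIn p i) ≈ 0#)
      liftᵢ≉0 rewrite insertAt-punchIn d p (sum (λ i → d i * scale i)) i = dᵢ≉0
      first≈0 = trans (combination-lift d zero) (combination-≈0 cleared d cleared-first)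
      tail≈0 = λ j j∈S → trans (combination-lift d (suc j)) (vanishes j j∈S)

  vanishingCombination : ∀ {k n} (S : Subset n) (vs : Fin k → Fin n → Carrier) →
                         ∣ S ∣ < k → VanishingCombination S vs
  vanishingCombination [] vs (s≤s _) = (λ _ → 1#) , (zero , 1≉0) , λ _ ()
  vanishingCombination (false ∷ S) vs |S|<k =
    dropColumn vs (λ ()) (vanishingCombination S (tails vs) |S|<k)
  vanishingCombination (true ∷ S) vs |S|<k with findNonzero (λ i → vs i zero)
  ... | inj₂ column≈0 =
    dropColumn vs (λ _ → column≈0) (vanishingCombination S (tails vs) (ℕₚ.<⇒≤ |S|<k))
  vanishingCombination {suc k} (true ∷ S) vs (s≤s |S|<k) | inj₁ (p , a≉0)
    with inverse (vs p zero) a≉0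
  ... | a⁻¹ , inv = liftVanishing (vanishingCombination S (tails cleared) |S|<k)
    where open Pivot vs p a⁻¹ inv

  combination-inKernel : ∀ {k n} {A : Matrix ℝ n} {vs : Fin k → Fin n → Carrier} →
                         (∀ i → InKernel ℝ A (vs i)) → ∀ c → InKernel ℝ A (combination vs c)
  combination-inKernel {A = A} {vs} vs∈ker c r = begin
    Σᶠ ℝ (λ j → A r j * combination vs c j)
      ≡⟨ Σᶠ≡sum (λ j → A r j * combination vs c j) ⟩
    sum (λ j → A r j * sum (λ i → c i * vs i j))
      ≈⟨ sum-cong-≋ (λ j → *-distribˡ-sum (A r j) (λ i → c i * vs i j)) ⟩
    sum (λ j → sum (λ i → A r j * (c i * vs i j)))
      ≈⟨ sum-cong-≋ (λ j → sum-cong-≋ λ i → x∙yz≈y∙xz (A r j) (c i) (vs i j)) ⟩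
    sum (λ j → sum (λ i → c i * (A r j * vs i j)))
      ≈⟨ ∑-comm (λ j i → c i * (A r j * vs i j)) ⟩
    sum (λ i → sum (λ j → c i * (A r j * vs i j)))
      ≈⟨ sum-cong-≋ (λ i → *-distribˡ-sum (c i) (λ j → A r j * vs i j)) ⟨
    sum (λ i → c i * sum (λ j → A r j * vs i j))
      ≈⟨ sum-zero (λ i → trans (*-congˡ (vsᵢ≈0 i)) (zeroʳ (c i))) ⟩
    0#
      ∎
    where
    vsᵢ≈0 : ∀ i → sum (λ j → A r j * vs i j) ≈ 0#
    vsᵢ≈0 i = trans (reflexive (≡.sym (Σᶠ≡sum (λ j → A r j * vs i j)))) (vs∈ker i r)

  black⇒≈0 : ∀ {n} {G : Graph n} {A : Matrix ℝ n} {S : Subset n} {x : Fin n → Carrier} →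
             InS ℝ G A → InKernel ℝ A x → (∀ v → v ∈ S → x v ≈ 0#) →
             ∀ {v} → Black G S v → x v ≈ 0#
  black⇒≈0 A∈S x∈ker x|S≈0 (init v∈S) = x|S≈0 _ v∈S
  black⇒≈0 {G = G} {A} {x = x} A∈S x∈ker x|S≈0 (force {u} {v} u-black uv others-black) =
    *-cancelˡ-≈0 Auv≉0 (begin
      A u v * x v               ≈⟨ sum-single v others≈0 ⟨
      sum (λ j → A u j * x j)   ≡⟨ Σᶠ≡sum (λ j → A u j * x j) ⟨
      Σᶠ ℝ (λ j → A u j * x j)  ≈⟨ x∈ker u ⟩
      0#                        ∎)
    where
    recurse = black⇒≈0 A∈S x∈ker x|S≈0

    u≢v : u ≢ v
    u≢v ≡.refl = Graph.irrefl G uv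

    Auv≉0 : ¬ (A u v ≈ 0#)
    Auv≉0 = proj₁ (proj₂ A∈S u v u≢v) uv

    others≈0 : ∀ j → j ≢ v → A u j * x j ≈ 0#
    others≈0 j j≢v with j ≟ᶠ u | A u j ≈0?
    ... | yes ≡.refl | _         = trans (*-congˡ (recurse u-black)) (zeroʳ _)
    ... | no  _      | yes Auj≈0 = trans (*-congʳ Auj≈0) (zeroˡ _)
    ... | no  j≢u    | no Auj≉0  = trans (*-congˡ (recurse (others-black j uj j≢v))) (zeroʳ _)
      where uj = proj₂ (proj₂ A∈S u j (λ u≡j → j≢u (≡.sym u≡j))) Auj≉0

  nullity≤∣zeroForcingSet∣ : ∀ {n k} {G : Graph n} {A : Matrix ℝ n} {S : Subset n} →
                             InS ℝ G A → IsZeroForcingSet G S → NullityAtLeast ℝ A k → k ≤ ∣ S ∣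
  nullity≤∣zeroForcingSet∣ {k = k} {S = S} A∈S S-forces (vs , vs∈ker , vs-indep) with k ≤? ∣ S ∣
  ... | yes k≤∣S∣ = k≤∣S∣
  ... | no  k≰∣S∣ with vanishingCombination S vs (ℕₚ.≰⇒> k≰∣S∣)
  ...   | c , (i , cᵢ≉0) , vanishes = contradiction (vs-indep c combination≈0 i) cᵢ≉0
    where
    combination≈0 : ∀ j → Σᶠ ℝ (λ i → c i * vs i j) ≈ 0#
    combination≈0 j = trans (reflexive (Σᶠ≡sum (λ i → c i * vs i j)))
      (black⇒≈0 A∈S (combination-inKernel vs∈ker c) vanishes (S-forces j))

  maxNullity≡zeroForcingNumber : ∀ {n k} (G : Graph n) →
    (Σ (Matrix ℝ n) λ A → InS ℝ G A × NullityAtLeast ℝ A k) →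
    (Σ (Subset n) λ S → IsZeroForcingSet G S × ∣ S ∣ ≡ k) →
    MaxNullity ℝ G k × ZeroForcingNumber G k
  maxNullity≡zeroForcingNumber G (A , A∈S , A-nullity) (S , S-forces , ∣S∣≡k) =
    ((A , A∈S , A-nullity) ,
      λ B B∈S B-nullity →
        ℕₚ.<-irrefl (≡.sym ∣S∣≡k) (nullity≤∣zeroForcingSet∣ B∈S S-forces B-nullity)) ,
    ((S , S-forces , ∣S∣≡k) , λ T T-forces → nullity≤∣zeroForcingSet∣ A∈S T-forces A-nullity)

  pivots⇒linIndep : ∀ {k n} (vs : Fin k → Fin n → Carrier) (piv : Fin k → Fin n) →
                    (∀ i → vs i (piv i) ≈ 1#) → (∀ i i′ → i ≢ i′ → vs i (piv i′) ≈ 0#) →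
                    LinIndep ℝ vs
  pivots⇒linIndep vs piv diag offDiag c vanishes i = begin
    c i                                 ≈⟨ *-identityʳ (c i) ⟨
    c i * 1#                            ≈⟨ *-congˡ (diag i) ⟨
    c i * vs i (piv i)                  ≈⟨ sum-single i others≈0 ⟨
    sum (λ i′ → c i′ * vs i′ (piv i))   ≡⟨ Σᶠ≡sum (λ i′ → c i′ * vs i′ (piv i)) ⟨
    Σᶠ ℝ (λ i′ → c i′ * vs i′ (piv i))  ≈⟨ vanishes (piv i) ⟩
    0#                                  ∎
    where
    others≈0 : ∀ i′ → i′ ≢ i → c i′ * vs i′ (piv i) ≈ 0#
    others≈0 i′ i′≢i = trans (*-congˡ (offDiag i′ i i′≢i)) (zeroʳ (c i′))

  ⟦_⟧ : ℕ → Carrier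
  ⟦ m ⟧ = m ×ᵣ 1#

  ⟦1⟧≈1# : ⟦ 1 ⟧ ≈ 1#
  ⟦1⟧≈1# = ×-homo-1 1#

  ⟦⟧-sum : ∀ {n} (f : Fin n → ℕ) → ⟦ sumℕ f ⟧ ≈ sum (⟦_⟧ ∘ f)
  ⟦⟧-sum {zero}  f = refl
  ⟦⟧-sum {suc n} f = trans (×-homo-+ 1# (f zero) _) (+-congˡ (⟦⟧-sum (f ∘ suc)))

  balanced⇒⟦⟧-orthogonal : ∀ {n} (a x y : Fin n → ℕ) →
    sumℕ (λ j → a j ℕ.* x j) ≡ sumℕ (λ j → a j ℕ.* y j) →
    sum (λ j → ⟦ a j ⟧ * (⟦ x j ⟧ - ⟦ y j ⟧)) ≈ 0#
  balanced⇒⟦⟧-orthogonal a x y balanced = begin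
    sum (λ j → ⟦ a j ⟧ * (⟦ x j ⟧ - ⟦ y j ⟧))
      ≈⟨ sum-cong-≋ (λ j → trans (distribˡ ⟦ a j ⟧ ⟦ x j ⟧ (- ⟦ y j ⟧))
                                 (+-congˡ (sym (-‿distribʳ-* ⟦ a j ⟧ ⟦ y j ⟧)))) ⟩
    sum (λ j → ⟦ a j ⟧ * ⟦ x j ⟧ + - (⟦ a j ⟧ * ⟦ y j ⟧))
      ≈⟨ ∑-distrib-+ (λ j → ⟦ a j ⟧ * ⟦ x j ⟧) (λ j → - (⟦ a j ⟧ * ⟦ y j ⟧)) ⟩
    sum (λ j → ⟦ a j ⟧ * ⟦ x j ⟧) + sum (λ j → - (⟦ a j ⟧ * ⟦ y j ⟧))
      ≈⟨ +-cong (⟦⟧-dot x) (trans (sum-neg (λ j → ⟦ a j ⟧ * ⟦ y j ⟧)) (-‿cong (⟦⟧-dot y))) ⟩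
    ⟦ sumℕ (λ j → a j ℕ.* x j) ⟧ - ⟦ sumℕ (λ j → a j ℕ.* y j) ⟧
      ≈⟨ +-congʳ (reflexive (≡.cong ⟦_⟧ balanced)) ⟩
    ⟦ sumℕ (λ j → a j ℕ.* y j) ⟧ - ⟦ sumℕ (λ j → a j ℕ.* y j) ⟧
      ≈⟨ -‿inverseʳ _ ⟩
    0#  ∎
    where
    ⟦⟧-dot : ∀ z → sum (λ j → ⟦ a j ⟧ * ⟦ z j ⟧) ≈ ⟦ sumℕ (λ j → a j ℕ.* z j) ⟧
    ⟦⟧-dot z = trans (sum-cong-≋ (λ j → sym (×1-homo-* (a j) (z j))))
                     (sym (⟦⟧-sum (λ j → a j ℕ.* z j)))

heawoodAdj? : ∀ u v → Dec (Graph.Adj Heawood u v)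
heawoodAdj? u v = T? (heawoodAdjB (toℕ u) (toℕ v))

heawoodZF : Subset 14
heawoodZF = ⁅ # 0 ⁆ ∪ ⁅ # 1 ⁆ ∪ ⁅ # 2 ⁆ ∪ ⁅ # 7 ⁆ ∪ ⁅ # 8 ⁆ ∪ ⁅ # 9 ⁆

heawoodForcingChain : List (Fin 14 × Fin 14)
heawoodForcingChain =
  (# 1 , # 12) ∷ (# 2 , # 13) ∷ (# 7 , # 3) ∷ (# 8 , # 4) ∷ (# 9 , # 5) ∷
  (# 0 , # 11) ∷ (# 3 , # 10) ∷ (# 12 , # 6) ∷ []

heawoodZF-isZeroForcing : IsZeroForcingSet Heawood heawoodZF
heawoodZF-isZeroForcing =
  forcingChain⇒zeroForcing Heawood heawoodAdj? heawoodZF heawoodForcingChain ≡.refl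

heawoodWeight : Fin 14 → Fin 14 → ℕ
heawoodWeight i j with i ≟ᶠ j
... | yes _ = if toℕ i ℕ.<ᵇ 7 then 1 else 2
... | no  _ = if heawoodAdjB (toℕ i) (toℕ j) then 1 else 0

heawoodWeight-sym : ∀ i j → heawoodWeight i j ≡ heawoodWeight j i
heawoodWeight-sym = from-yes (all? λ i → all? λ j → heawoodWeight i j ℕ.≟ heawoodWeight j i)

heawoodWeight-offDiagonal : ∀ i j → i ≢ j →
                            heawoodWeight i j ≡ (if heawoodAdjB (toℕ i) (toℕ j) then 1 else 0)
heawoodWeight-offDiagonal i j i≢j with i ≟ᶠ j
... | yes i≡j = contradiction i≡j i≢j
... | no  _   = ≡.refl

-- heawoodWeight is [[I, N], [Nᵀ, 2I]] with N the point-line incidence matrix. As Nᵀ N = 2I + J,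
-- its kernel is {(-N y, y) : Σ y = 0}; kernel⁺ - kernel⁻ is the basis given by y = e_i - e_6,
-- split into nonnegative parts so that A (x⁺ - x⁻) = 0 becomes the identity A x⁺ = A x⁻ in ℕ.
kernel⁺ kernel⁻ : Fin 6 → Fin 14 → ℕ
kernel⁺ i j = if toℕ j ℕ.<ᵇ 7 then (if onLine (toℕ j) 6 then 1 else 0)
              else (if toℕ j ℕ.∸ 7 ℕ.≡ᵇ toℕ i then 1 else 0)
kernel⁻ i j = if toℕ j ℕ.<ᵇ 7 then (if onLine (toℕ j) (toℕ i) then 1 else 0)
              else (if toℕ j ℕ.∸ 7 ℕ.≡ᵇ 6 then 1 else 0)

line : Fin 6 → Fin 14
line i = 7 ↑ʳ inject₁ i

kernel-balanced : ∀ r i → sumℕ (λ j → heawoodWeight r j ℕ.* kernel⁺ i j)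
                        ≡ sumℕ (λ j → heawoodWeight r j ℕ.* kernel⁻ i j)
kernel-balanced = from-yes (all? λ r → all? λ i →
  sumℕ (λ j → heawoodWeight r j ℕ.* kernel⁺ i j) ℕ.≟ sumℕ (λ j → heawoodWeight r j ℕ.* kernel⁻ i j))

kernel⁺-line : ∀ i → kernel⁺ i (line i) ≡ 1
kernel⁺-line = from-yes (all? λ i → kernel⁺ i (line i) ℕ.≟ 1)

kernel⁺-otherLine : ∀ i i′ → i ≢ i′ → kernel⁺ i (line i′) ≡ 0
kernel⁺-otherLine = from-yes (all? λ i → all? λ i′ → ¬? (i ≟ᶠ i′) →-dec kernel⁺ i (line i′) ℕ.≟ 0)

kernel⁻-line : ∀ i i′ → kernel⁻ i (line i′) ≡ 0
kernel⁻-line = from-yes (all? λ i → all? λ i′ → kernel⁻ i (line i′) ℕ.≟ 0)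

open Nullity using (maxNullity≡zeroForcingNumber)

module _ (ℝ : RealField) where
  open RealField ℝ hiding (zero; _<_)
  open Nullity ℝ
  open import Algebra.Properties.Group +-group using (ε⁻¹≈ε)

  heawoodMatrix : Matrix ℝ 14
  heawoodMatrix i j = ⟦ heawoodWeight i j ⟧

  heawoodMatrix∈S : InS ℝ Heawood heawoodMatrix
  heawoodMatrix∈S = (λ i j → reflexive (≡.cong ⟦_⟧ (heawoodWeight-sym i j))) , offDiagonal
    where
    offDiagonal : ∀ i j → i ≢ j →
                  (Graph.Adj Heawood i j → ¬ (heawoodMatrix i j ≈ 0#)) ×
                  (¬ (heawoodMatrix i j ≈ 0#) → Graph.Adj Heawood i j)
    offDiagonal i j i≢j rewrite heawoodWeight-offDiagonal i j i≢j with heawoodAdjB (toℕ i) (toℕ j)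
    ... | true  = (λ _ ⟦1⟧≈0 → 1≉0 (trans (sym ⟦1⟧≈1#) ⟦1⟧≈0)) , (λ _ → tt)
    ... | false = (λ ()) , (λ ⟦0⟧≉0 → contradiction refl ⟦0⟧≉0)

  heawoodKernelBasis : Fin 6 → Fin 14 → Carrier
  heawoodKernelBasis i j = ⟦ kernel⁺ i j ⟧ - ⟦ kernel⁻ i j ⟧

  heawoodNullity : NullityAtLeast ℝ heawoodMatrix 6
  heawoodNullity =
    heawoodKernelBasis , inKernel , pivots⇒linIndep heawoodKernelBasis line atOwnLine atOtherLine
    where
    inKernel : ∀ i → InKernel ℝ heawoodMatrix (heawoodKernelBasis i)
    inKernel i r = trans (reflexive (Σᶠ≡sum (λ j → heawoodMatrix r j * heawoodKernelBasis i j)))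
      (balanced⇒⟦⟧-orthogonal (heawoodWeight r) (kernel⁺ i) (kernel⁻ i) (kernel-balanced r i))

    atOwnLine : ∀ i → heawoodKernelBasis i (line i) ≈ 1#
    atOwnLine i rewrite kernel⁺-line i | kernel⁻-line i i =
      trans (+-cong ⟦1⟧≈1# ε⁻¹≈ε) (+-identityʳ 1#)

    atOtherLine : ∀ i i′ → i ≢ i′ → heawoodKernelBasis i (line i′) ≈ 0#
    atOtherLine i i′ i≢i′ rewrite kernel⁺-otherLine i i′ i≢i′ | kernel⁻-line i i′ = -‿inverseʳ 0#

theorem11 : (ℝ : RealField) → MaxNullity ℝ Heawood 6 × ZeroForcingNumber Heawood 6
theorem11 ℝ = maxNullity≡zeroForcingNumber ℝ Heawood
  (heawoodMatrix ℝ , heawoodMatrix∈S ℝ , heawoodNullity ℝ)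
  (heawoodZF , heawoodZF-isZeroForcing , ≡.refl)
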